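{- Let $u,v,x,y,z$ be commuting indeterminates and let $D_1,D_2$ be the derivations of the field $\mathbb Q(u,v,x,y,z)$ determined by $$D_1(x)=D_1(y)=D_1(z)=uv,\quad D_1(u)=D_1(v)=0,$$ $$D_2(x)=D_2(y)=D_2(z)=\frac{x^2y^2z}{uv},\quad D_2(u)=\frac{xyz^2}{v},\quad D_2(v)=\frac{xyz^2}{u}.$$ Then for $n\ge1$, $$D_1(D_2D_1)^{n-1}(x)=uv\,H_n(x,y,z),\qquad (D_2D_1)^n(x)=L_n(x,y,z),$$ where $(D_2D_1)^n$ denotes $n$-fold application of $D_1$ followed by $D_2$.
   Context: For $n\ge1$, $N_n=\{1,1,\overline1,2,2,\overline2,\dots,n,n,\overline n\}$ (two unbarred copies and one barred copy of each $i\in[n]$), ordered by $\overline1=1<\overline2=2<\cdots<\overline n=n$ (a barred and an unbarred copy of the same integer compare as equal). For a sub-multiset $M$ of $N_n$, a Legendre-Stirling permutation of $M$ is a word $\pi_1\cdots\pi_m$ using the elements of $M$ such that whenever $i<j<k$, $\pi_i,\pi_k$ are unbarred and $\pi_i=\pi_k$, then $\pi_j>\pi_i$. $\mathrm{LS}_n$ is the set of Legendre-Stirling permutations of $N_n$, and $\mathrm{LSD}_n$ the set of Legendre-Stirling permutations of $N_n\setminus\{n,n\}$. For such $\pi$ of length $m$ set $\pi_0=\pi_{m+1}=0$; for $0\le i\le m$, $i$ is an ascent, descent or plateau if $\pi_i<\pi_{i+1}$, $\pi_i>\pi_{i+1}$ or $\pi_i=\pi_{i+1}$; $\mathrm{asc},\mathrm{des},\mathrm{plat}$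 count them. $H_n(x,y,z)=\sum_{\pi\in\mathrm{LSD}_n}x^{\mathrm{asc}(\pi)-1}y^{\mathrm{des}(\pi)-1}z^{\mathrm{plat}(\pi)}$, $L_n(x,y,z)=\sum_{\pi\in\mathrm{LS}_n}x^{\mathrm{asc}(\pi)}y^{\mathrm{des}(\pi)}z^{\mathrm{plat}(\pi)}$. -}

module Defs where

open import Data.Nat as ℕ using (ℕ; zero; suc; _∸_; _<ᵇ_; _≡ᵇ_)
open import Data.Integer as ℤ using (ℤ; +_; 0ℤ; 1ℤ; -1ℤ)
open import Data.Bool using (Bool; true; false; _∧_; if_then_else_)
open import Data.List using (List; []; _∷_; _++_; map; concatMap; upTo; length; lookup)
open import Data.List.Membership.Propositional using (_∈_)
open import Data.List.Relation.Unary.Unique.Propositional using (Unique)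
open import Data.List.Relation.Binary.Permutation.Propositional using (_↭_)
open import Data.Product using (_×_; _,_; proj₁; proj₂)
open import Data.Fin as Fin using (Fin)
open import Relation.Nullary.Decidable using (⌊_⌋)
open import Relation.Binary.PropositionalEquality using (_≡_)

-- Laurent polynomials in u, v, x, y, z with integer coefficients.
-- This ring is a subring of Q(u,v,x,y,z) stable under D₁ and D₂,
-- so computing there is the same as computing in the field.

record Mono : Set where
  constructor mono
  field
    eu ev ex ey ez : ℤ
open Mono public

eqM : Mono → Mono → Bool
eqM (mono a b c d e) (mono a' b' c' d' e') =
  ⌊ a ℤ.≟ a' ⌋ ∧ ⌊ b ℤ.≟ b' ⌋ ∧ ⌊ c ℤ.≟ c' ⌋ ∧ ⌊ d ℤ.≟ d' ⌋ ∧ ⌊ e ℤ.≟ e' ⌋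

monoMul : Mono → Mono → Mono
monoMul (mono a b c d e) (mono a' b' c' d' e') =
  mono (a ℤ.+ a') (b ℤ.+ b') (c ℤ.+ c') (d ℤ.+ d') (e ℤ.+ e')

Poly : Set
Poly = List (ℤ × Mono)

coeff : Poly → Mono → ℤ
coeff [] m = 0ℤ
coeff ((c , m') ∷ p) m = (if eqM m' m then c else 0ℤ) ℤ.+ coeff p m

infix 4 _≈_
_≈_ : Poly → Poly → Set
p ≈ q = ∀ m → coeff p m ≡ coeff q m

infixl 7 _⋆_
_⋆_ : Poly → Poly → Poly
p ⋆ q = concatMap (λ { (c , m) → map (λ { (d , m') → (c ℤ.* d , monoMul m m') }) q }) p

data Var : Set where
  U V X Y Z : Var

vars : List Var
vars = U ∷ V ∷ X ∷ Y ∷ Z ∷ []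

expo : Var → Mono → ℤ
expo U m = eu m
expo V m = ev m
expo X m = ex m
expo Y m = ey m
expo Z m = ez m

lower : Var → Mono → Mono
lower U (mono a b c d e) = mono (a ℤ.- 1ℤ) b c d e
lower V (mono a b c d e) = mono a (b ℤ.- 1ℤ) c d e
lower X (mono a b c d e) = mono a b (c ℤ.- 1ℤ) d e
lower Y (mono a b c d e) = mono a b c (d ℤ.- 1ℤ) e
lower Z (mono a b c d e) = mono a b c d (e ℤ.- 1ℤ)

-- The unique derivation (additive, Leibniz, kills constants) with D(w) = g w
-- for each variable w:  D(c·m) = Σ_w c · (∂m/∂w) · g w.
derivation : (Var → Poly) → Poly → Poly
derivation g p =
  concatMap (λ { (c , m) →
    concatMap (λ w → ((c ℤ.* expo w m , lower w m) ∷ []) ⋆ g w) vars }) p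

D₁img : Var → Poly
D₁img U = []
D₁img V = []
D₁img X = (1ℤ , mono 1ℤ 1ℤ 0ℤ 0ℤ 0ℤ) ∷ []
D₁img Y = (1ℤ , mono 1ℤ 1ℤ 0ℤ 0ℤ 0ℤ) ∷ []
D₁img Z = (1ℤ , mono 1ℤ 1ℤ 0ℤ 0ℤ 0ℤ) ∷ []

D₂img : Var → Poly
D₂img U = (1ℤ , mono 0ℤ -1ℤ 1ℤ 1ℤ (+ 2)) ∷ []
D₂img V = (1ℤ , mono -1ℤ 0ℤ 1ℤ 1ℤ (+ 2)) ∷ []
D₂img X = (1ℤ , mono -1ℤ -1ℤ (+ 2) (+ 2) 1ℤ) ∷ []
D₂img Y = (1ℤ , mono -1ℤ -1ℤ (+ 2) (+ 2) 1ℤ) ∷ []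
D₂img Z = (1ℤ , mono -1ℤ -1ℤ (+ 2) (+ 2) 1ℤ) ∷ []

D₁ D₂ : Poly → Poly
D₁ = derivation D₁img
D₂ = derivation D₂img

D₂D₁ : Poly → Poly
D₂D₁ p = D₂ (D₁ p)

iter : {A : Set} → ℕ → (A → A) → A → A
iter zero f a = a
iter (suc n) f a = f (iter n f a)

xP : Poly
xP = (1ℤ , mono 0ℤ 0ℤ 1ℤ 0ℤ 0ℤ) ∷ []

uvP : Poly
uvP = (1ℤ , mono 1ℤ 1ℤ 0ℤ 0ℤ 0ℤ) ∷ []

-- A letter (i , b): the integer i, barred iff b ≡ true.
Letter : Set
Letter = ℕ × Bool

Word : Set
Word = List Letter

Nmult : ℕ → List Letter
Nmult n = concatMap (λ i → (suc i , false) ∷ (suc i , false) ∷ (suc i , true) ∷ []) (upTo n)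

LSDmult : ℕ → List Letter
LSDmult n = Nmult (n ∸ 1) ++ ((n , true) ∷ [])

IsLS : Word → Set
IsLS w = (i j k : Fin (length w)) → i Fin.< j → j Fin.< k →
  proj₂ (lookup w i) ≡ false → proj₂ (lookup w k) ≡ false →
  proj₁ (lookup w i) ≡ proj₁ (lookup w k) →
  proj₁ (lookup w i) ℕ.< proj₁ (lookup w j)

LSPerm : List Letter → Word → Set
LSPerm M w = (w ↭ M) × IsLS w

Enumerates : (Word → Set) → List Word → Set
Enumerates P ws = Unique ws × ((w : Word) → w ∈ ws → P w) × ((w : Word) → P w → w ∈ ws)

padded : Word → List ℕ
padded w = 0 ∷ (map proj₁ w ++ (0 ∷ []))

countPairs : (ℕ → ℕ → Bool) → List ℕ → ℕ
countPairs R (a ∷ b ∷ r) = (if R a b then 1 else 0) ℕ.+ countPairs R (b ∷ r)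
countPairs R _ = 0

asc des plat : Word → ℕ
asc w = countPairs (λ a b → a <ᵇ b) (padded w)
des w = countPairs (λ a b → b <ᵇ a) (padded w)
plat w = countPairs (λ a b → a ≡ᵇ b) (padded w)

Hpoly : List Word → Poly
Hpoly ws = map (λ w → (1ℤ , mono 0ℤ 0ℤ (+ asc w ℤ.- 1ℤ) (+ des w ℤ.- 1ℤ) (+ plat w))) ws

Lpoly : List Word → Poly
Lpoly ws = map (λ w → (1ℤ , mono 0ℤ 0ℤ (+ asc w) (+ des w) (+ plat w))) ws

-- A word π is recorded by its monomial x^asc y^des z^plat: the product, over the gaps of π (adjacent pairs
-- in 0 π 0), of x, y or z according as the gap is an ascent, a descent or a plateau. Inserting a new largest
-- letter into a gap of class w divides this monomial by w and multiplies it by the monomial of the new pairs.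
-- For n̄ inserted into a word of LS_{n-1} with monomial m that factor is xy, so the new word contributes
-- uv · m / w to uv H_n, which is the w-term of D₁ m; as the classes of the gaps multiply to m, summing over
-- the gaps gives D₁ L_{n-1} = uv H_n. For n n inserted into a word of LSD_n, counting the two gaps next to n̄
-- as u and v makes the classes multiply to its H-monomial h, and the new word contributes h · D₂ w / w, so
-- D₂ (uv H_n) = L_n. These insertions enumerate LSD_n and LS_n without repetition, and any two enumerations
-- of a set are permutations of each other.

module Submission where

open import Defs
open import Algebra.Bundles using (CommutativeMonoid)
import Algebra.Properties.CommutativeSemigroup as CommSemigroupProperties
open import Data.Bool using (true; false; if_then_else_; T)
open import Data.Bool.Properties using (T-≡)
open import Data.Empty using (⊥-elim)
open import Data.Fin as Fin using (Fin; zero; suc)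
open import Data.Integer as ℤ using (ℤ; +_; 0ℤ; 1ℤ; -1ℤ; _+_; _*_; -_; _-_)
import Data.Integer.Properties as ℤₚ
open import Data.Integer.Tactic.RingSolver using (solve-∀)
open import Data.List using (List; []; _∷_; _++_; map; concatMap; foldr; upTo; length; lookup; [_])
import Data.List.Properties as Listₚ
open import Data.List.Membership.Propositional using (_∈_; _∉_; find; lose)
open import Data.List.Membership.Propositional.Properties
  using (∈-map⁺; ∈-map⁻; ∈-∃++; ∈-++⁺ˡ; ∈-++⁺ʳ; ∈-++⁻; ∈-concatMap⁺; ∈-concatMap⁻)
open import Data.List.Membership.Propositional.Properties.WithK using (unique∧set⇒bag)
open import Data.List.Relation.Binary.BagAndSetEquality using (∼bag⇒↭)
open import Data.List.Relation.Binary.Permutation.Propositional as ↭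
  using (_↭_; ↭-refl; ↭-sym; ↭-trans; ↭-prep)
import Data.List.Relation.Binary.Permutation.Propositional.Properties as ↭ₚ
open import Data.List.Relation.Binary.Pointwise as Pointwise using (Pointwise; []; _∷_; Pointwise-≡⇒≡)
open import Data.List.Relation.Binary.Sublist.Propositional using (_⊆_; []; _∷_; _∷ʳ_; ⊆-refl)
import Data.List.Relation.Binary.Sublist.Propositional.Properties as Sublistₚ
open import Data.List.Relation.Unary.All as All using (All; []; _∷_)
import Data.List.Relation.Unary.All.Properties as Allₚ
open import Data.List.Relation.Unary.Any as Any using (Any; here; there)
import Data.List.Relation.Unary.Any.Properties as Anyₚ
open import Data.List.Relation.Unary.Unique.Propositional using (Unique; []; _∷_)
import Data.List.Relation.Unary.Unique.Propositional.Properties as Uniqueₚ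
open import Data.Nat as ℕ using (ℕ; zero; suc; _≤_; _<_; _∸_; z≤n; s≤s; z<s; s<s; _<ᵇ_; _≡ᵇ_)
import Data.Nat.Properties as ℕₚ
open import Data.Product using (_×_; _,_; proj₁; proj₂; ∃; ∃₂)
open import Data.Sum using (_⊎_; inj₁; inj₂)
open import Data.Unit using (⊤; tt)
open import Function using (_∘_; _⇔_; mk⇔; Equivalence)
open import Relation.Nullary using (¬_; yes; no; contradiction)
open import Relation.Nullary.Reflects using (Reflects; ofʸ; ofⁿ; det)
open import Relation.Binary.Bundles using (Setoid)
open import Relation.Binary.Definitions using (tri<; tri≈; tri>)
open import Relation.Binary.PropositionalEquality hiding ([_])
import Relation.Binary.Reasoning.Setoid as SetoidReasoning

mono-ext : ∀ {m m′} → eu m ≡ eu m′ → ev m ≡ ev m′ → ex m ≡ ex m′ → ey m ≡ ey m′ → ez m ≡ ez m′ →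
           m ≡ m′
mono-ext refl refl refl refl refl = refl

one : Mono
one = mono 0ℤ 0ℤ 0ℤ 0ℤ 0ℤ

infixl 7 _·_
infix 8 _⁻¹

_·_ : Mono → Mono → Mono
_·_ = monoMul

_⁻¹ : Mono → Mono
(mono a b c d e) ⁻¹ = mono (- a) (- b) (- c) (- d) (- e)

varMono : Var → Mono
varMono U = mono 1ℤ 0ℤ 0ℤ 0ℤ 0ℤ
varMono V = mono 0ℤ 1ℤ 0ℤ 0ℤ 0ℤ
varMono X = mono 0ℤ 0ℤ 1ℤ 0ℤ 0ℤ
varMono Y = mono 0ℤ 0ℤ 0ℤ 1ℤ 0ℤ
varMono Z = mono 0ℤ 0ℤ 0ℤ 0ℤ 1ℤ

uv xy : Mono
uv = mono 1ℤ 1ℤ 0ℤ 0ℤ 0ℤ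
xy = varMono X · varMono Y

·-assoc : ∀ a b c → a · b · c ≡ a · (b · c)
·-assoc a b c = mono-ext (assoc eu) (assoc ev) (assoc ex) (assoc ey) (assoc ez)
  where
  assoc : (e : Mono → ℤ) → (e a + e b) + e c ≡ e a + (e b + e c)
  assoc e = ℤₚ.+-assoc (e a) (e b) (e c)

·-comm : ∀ a b → a · b ≡ b · a
·-comm a b = mono-ext (comm eu) (comm ev) (comm ex) (comm ey) (comm ez)
  where
  comm : (e : Mono → ℤ) → e a + e b ≡ e b + e a
  comm e = ℤₚ.+-comm (e a) (e b)

·-identityˡ : ∀ a → one · a ≡ a
·-identityˡ a = mono-ext (identity eu) (identity ev) (identity ex) (identity ey) (identity ez)
  where
  identity : (e : Mono → ℤ) → 0ℤ + e a ≡ e a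
  identity e = ℤₚ.+-identityˡ (e a)

·-cancelʳ : ∀ a g → a · g · g ⁻¹ ≡ a
·-cancelʳ a g = mono-ext (cancel eu) (cancel ev) (cancel ex) (cancel ey) (cancel ez)
  where
  h : ∀ x y → (x + y) + - y ≡ x
  h = solve-∀
  cancel : (e : Mono → ℤ) → (e a + e g) + - e g ≡ e a
  cancel e = h (e a) (e g)

⁻¹-cancelʳ : ∀ a g → a · g ⁻¹ · g ≡ a
⁻¹-cancelʳ a g = mono-ext (cancel eu) (cancel ev) (cancel ex) (cancel ey) (cancel ez)
  where
  h : ∀ x y → (x + - y) + y ≡ x
  h = solve-∀
  cancel : (e : Mono → ℤ) → (e a + - e g) + e g ≡ e a
  cancel e = h (e a) (e g)

·-commutativeMonoid : CommutativeMonoid _ _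
·-commutativeMonoid = record
  { Carrier = Mono
  ; _≈_ = _≡_
  ; _∙_ = _·_
  ; ε = one
  ; isCommutativeMonoid = record
    { isMonoid = record
      { isSemigroup = record
        { isMagma = record { isEquivalence = isEquivalence ; ∙-cong = cong₂ _·_ }
        ; assoc = ·-assoc
        }
      ; identity = ·-identityˡ , λ a → trans (·-comm a one) (·-identityˡ a)
      }
    ; comm = ·-comm
    }
  }

module MonoMul = CommSemigroupProperties (CommutativeMonoid.commutativeSemigroup ·-commutativeMonoid)

monoProd : List Mono → Mono
monoProd = foldr _·_ one

monoProd-++ : ∀ ms ns → monoProd (ms ++ ns) ≡ monoProd ms · monoProd ns
monoProd-++ [] ns = sym (·-identityˡ (monoProd ns))
monoProd-++ (m ∷ ms) ns =
  trans (cong (m ·_) (monoProd-++ ms ns)) (sym (·-assoc m (monoProd ms) (monoProd ns)))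

·-solve : ∀ g k m → m · g ≡ k ⇔ m ≡ k · g ⁻¹
·-solve g k m = mk⇔ (λ { refl → sym (·-cancelʳ m g) }) (λ { refl → ⁻¹-cancelʳ k g })

divide : ∀ A G B K → A · G ≡ B · K → A ≡ B · (K · G ⁻¹)
divide A G B K A·G≡B·K = begin
  A               ≡⟨ ·-cancelʳ A G ⟨
  A · G · G ⁻¹    ≡⟨ cong (_· G ⁻¹) A·G≡B·K ⟩
  B · K · G ⁻¹    ≡⟨ ·-assoc B K (G ⁻¹) ⟩
  B · (K · G ⁻¹)  ∎
  where open ≡-Reasoning

x≡x+0 : ∀ a → a ≡ a + 0ℤ
x≡x+0 a = sym (ℤₚ.+-identityʳ a)

lower-· : ∀ w m → lower w m ≡ m · varMono w ⁻¹
lower-· U (mono a b c d e) = mono-ext refl (x≡x+0 b) (x≡x+0 c) (x≡x+0 d) (x≡x+0 e)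
lower-· V (mono a b c d e) = mono-ext (x≡x+0 a) refl (x≡x+0 c) (x≡x+0 d) (x≡x+0 e)
lower-· X (mono a b c d e) = mono-ext (x≡x+0 a) (x≡x+0 b) refl (x≡x+0 d) (x≡x+0 e)
lower-· Y (mono a b c d e) = mono-ext (x≡x+0 a) (x≡x+0 b) (x≡x+0 c) refl (x≡x+0 e)
lower-· Z (mono a b c d e) = mono-ext (x≡x+0 a) (x≡x+0 b) (x≡x+0 c) (x≡x+0 d) refl

eqM-reflects : ∀ m k → Reflects (m ≡ k) (eqM m k)
eqM-reflects (mono a b c d e) (mono a′ b′ c′ d′ e′)
  with a ℤ.≟ a′ | b ℤ.≟ b′ | c ℤ.≟ c′ | d ℤ.≟ d′ | e ℤ.≟ e′
... | yes refl | yes refl | yes refl | yes refl | yes refl = ofʸ refl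
... | no a≢a′  | _        | _        | _        | _        = ofⁿ (a≢a′ ∘ cong eu)
... | yes _    | no b≢b′  | _        | _        | _        = ofⁿ (b≢b′ ∘ cong ev)
... | yes _    | yes _    | no c≢c′  | _        | _        = ofⁿ (c≢c′ ∘ cong ex)
... | yes _    | yes _    | yes _    | no d≢d′  | _        = ofⁿ (d≢d′ ∘ cong ey)
... | yes _    | yes _    | yes _    | yes _    | no e≢e′  = ofⁿ (e≢e′ ∘ cong ez)

eqM-cong : ∀ {m k m′ k′} → (m ≡ k ⇔ m′ ≡ k′) → eqM m k ≡ eqM m′ k′
eqM-cong {m} {k} {m′} {k′} m≡k⇔m′≡k′ = det (eqM-reflects m k) (transport (eqM-reflects m′ k′))
  where
  open Equivalence m≡k⇔m′≡k′
  transport : ∀ {b} → Reflects (m′ ≡ k′) b → Reflects (m ≡ k) b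
  transport (ofʸ p) = ofʸ (from p)
  transport (ofⁿ ¬p) = ofⁿ (¬p ∘ to)

-- Laurent polynomials up to ≈

module ℤ+ = CommSemigroupProperties ℤₚ.+-commutativeSemigroup

-- unlike the function type ≈, this record determines both polynomials, so that they can be inferred
infix 4 _≋_
record _≋_ (p q : Poly) : Set where
  constructor mk≋
  field coeff-≡ : p ≈ q
open _≋_ public

≋-setoid : Setoid _ _
≋-setoid = record
  { Carrier = Poly
  ; _≈_ = _≋_
  ; isEquivalence = record
    { refl = mk≋ λ _ → refl
    ; sym = λ p≋q → mk≋ λ m → sym (coeff-≡ p≋q m)
    ; trans = λ p≋q q≋r → mk≋ λ m → trans (coeff-≡ p≋q m) (coeff-≡ q≋r m)
    }
  }

open Setoid ≋-setoid public using () renaming (refl to ≋-refl; sym to ≋-sym; trans to ≋-trans)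

termCoeff : ℤ × Mono → Mono → ℤ
termCoeff (c , m′) m = if eqM m′ m then c else 0ℤ

coeff-++ : ∀ p q m → coeff (p ++ q) m ≡ coeff p m + coeff q m
coeff-++ [] q m = sym (ℤₚ.+-identityˡ _)
coeff-++ (t ∷ p) q m = trans (cong (λ r → termCoeff t m + r) (coeff-++ p q m))
                             (sym (ℤₚ.+-assoc (termCoeff t m) (coeff p m) (coeff q m)))

++-cong : ∀ {p p′ q q′} → p ≋ p′ → q ≋ q′ → p ++ q ≋ p′ ++ q′
++-cong {p} {p′} {q} {q′} p≋p′ q≋q′ = mk≋ λ m → begin
  coeff (p ++ q) m          ≡⟨ coeff-++ p q m ⟩
  coeff p m + coeff q m     ≡⟨ cong₂ _+_ (coeff-≡ p≋p′ m) (coeff-≡ q≋q′ m) ⟩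
  coeff p′ m + coeff q′ m   ≡⟨ coeff-++ p′ q′ m ⟨
  coeff (p′ ++ q′) m        ∎
  where open ≡-Reasoning

∷-cong : ∀ t {p q} → p ≋ q → t ∷ p ≋ t ∷ q
∷-cong t = ++-cong {p = t ∷ []} ≋-refl

if-zero : ∀ b → (if b then 0ℤ else 0ℤ) ≡ 0ℤ
if-zero true = refl
if-zero false = refl

zero-term : ∀ {c} m {p} → c ≡ 0ℤ → (c , m) ∷ p ≋ p
zero-term m′ {p} refl = mk≋ λ m →
  trans (cong (_+ coeff p m) (if-zero (eqM m′ m))) (ℤₚ.+-identityˡ (coeff p m))

zero-terms : ∀ {p} → All (λ t → proj₁ t ≡ 0ℤ) p → p ≋ []
zero-terms [] = ≋-refl
zero-terms (c≡0 ∷ zs) = ≋-trans (zero-term _ c≡0) (zero-terms zs)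

concatMap-cong : ∀ {A : Set} {f g : A → Poly} {xs} → All (λ x → f x ≋ g x) xs →
  concatMap f xs ≋ concatMap g xs
concatMap-cong [] = ≋-refl
concatMap-cong (fx≋gx ∷ f≋g) = ++-cong fx≋gx (concatMap-cong f≋g)

↭⇒≋ : ∀ {p q} → p ↭ q → p ≋ q
↭⇒≋ ↭.refl = ≋-refl
↭⇒≋ (↭.prep t p↭q) = ∷-cong t (↭⇒≋ p↭q)
↭⇒≋ (↭.swap {ys = q} s t p↭q) = mk≋ λ m →
  trans (cong (λ r → termCoeff s m + (termCoeff t m + r)) (coeff-≡ (↭⇒≋ p↭q) m))
        (ℤ+.x∙yz≈y∙xz (termCoeff s m) (termCoeff t m) (coeff q m))
↭⇒≋ (↭.trans p↭q q↭r) = ≋-trans (↭⇒≋ p↭q) (↭⇒≋ q↭r)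

if-+ : ∀ b x y → (if b then x + y else 0ℤ) ≡ (if b then x else 0ℤ) + (if b then y else 0ℤ)
if-+ true x y = refl
if-+ false x y = refl

map-+-≋ : ∀ {A : Set} (a b : A → ℤ) (f : A → Mono) xs →
  map (λ x → (a x + b x , f x)) xs ≋ map (λ x → (a x , f x)) xs ++ map (λ x → (b x , f x)) xs
map-+-≋ a b f [] = ≋-refl
map-+-≋ a b f (x ∷ xs) = mk≋ λ m → let α = termCoeff (a x , f x) m; β = termCoeff (b x , f x) m in begin
  termCoeff (a x + b x , f x) m + coeff (map (λ x → (a x + b x , f x)) xs) m
    ≡⟨ cong₂ _+_ (if-+ (eqM (f x) m) (a x) (b x))
                 (trans (coeff-≡ (map-+-≋ a b f xs) m) (coeff-++ A B m)) ⟩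
  (α + β) + (coeff A m + coeff B m)
    ≡⟨ interchange α β (coeff A m) (coeff B m) ⟩
  α + (coeff A m + (β + coeff B m))
    ≡⟨ cong (λ r → α + r) (coeff-++ A ((b x , f x) ∷ B) m) ⟨
  α + coeff (A ++ (b x , f x) ∷ B) m ∎
  where
  open ≡-Reasoning
  A B : Poly
  A = map (λ x → (a x , f x)) xs
  B = map (λ x → (b x , f x)) xs
  interchange : ∀ α β A B → (α + β) + (A + B) ≡ α + (A + (β + B))
  interchange = solve-∀

isolate : ∀ {p t q} → All (λ t → proj₁ t ≡ 0ℤ) p → All (λ t → proj₁ t ≡ 0ℤ) q →
  p ++ t ∷ q ≋ t ∷ []
isolate [] zq = ∷-cong _ (zero-terms zq)
isolate (c≡0 ∷ zp) zq = ≋-trans (zero-term _ c≡0) (isolate zp zq)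

indicator : ∀ (Φ : Var → Mono) v → (1ℤ , Φ v) ∷ [] ≋ map (λ w → (expo w (varMono v) , Φ w)) vars
indicator Φ U = ≋-sym (isolate [] (refl ∷ refl ∷ refl ∷ refl ∷ []))
indicator Φ V = ≋-sym (isolate (refl ∷ []) (refl ∷ refl ∷ refl ∷ []))
indicator Φ X = ≋-sym (isolate (refl ∷ refl ∷ []) (refl ∷ refl ∷ []))
indicator Φ Y = ≋-sym (isolate (refl ∷ refl ∷ refl ∷ []) (refl ∷ []))
indicator Φ Z = ≋-sym (isolate (refl ∷ refl ∷ refl ∷ refl ∷ []) [])

collect : ∀ {A : Set} (Φ : Var → Mono) (cls : A → Var) G →
  map (λ g → (1ℤ , Φ (cls g))) G ≋ map (λ w → (expo w (monoProd (map (varMono ∘ cls) G)) , Φ w)) vars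
collect Φ cls [] = ≋-sym (zero-terms (refl ∷ refl ∷ refl ∷ refl ∷ refl ∷ []))
collect Φ cls (g ∷ G) = begin
  (1ℤ , Φ (cls g)) ∷ map (λ g → (1ℤ , Φ (cls g))) G
    ≈⟨ ∷-cong _ (collect Φ cls G) ⟩
  (1ℤ , Φ (cls g)) ∷ map (λ w → (expo w C , Φ w)) vars
    ≈⟨ ++-cong (indicator Φ (cls g)) ≋-refl ⟩
  map (λ w → (expo w (varMono (cls g)) , Φ w)) vars ++ map (λ w → (expo w C , Φ w)) vars
    ≈⟨ map-+-≋ (λ w → expo w (varMono (cls g))) (λ w → expo w C) Φ vars ⟨
  map (λ w → (expo w (varMono (cls g) · C) , Φ w)) vars ∎
  where
  open SetoidReasoning ≋-setoid
  C : Mono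
  C = monoProd (map (varMono ∘ cls) G)

-- Derivations sending each variable to a monomial

sumVars : (Var → ℤ) → ℤ
sumVars f = f U + (f V + (f X + (f Y + (f Z + 0ℤ))))

sumVars-+ : ∀ f g → sumVars (λ w → f w + g w) ≡ sumVars f + sumVars g
sumVars-+ f g = h (f U) (f V) (f X) (f Y) (f Z) (g U) (g V) (g X) (g Y) (g Z)
  where
  h : ∀ a b c d e a′ b′ c′ d′ e′ →
      (a + a′) + ((b + b′) + ((c + c′) + ((d + d′) + ((e + e′) + 0ℤ))))
      ≡ (a + (b + (c + (d + (e + 0ℤ))))) + (a′ + (b′ + (c′ + (d′ + (e′ + 0ℤ)))))
  h = solve-∀

sumVars-cong : ∀ {f g} → (∀ w → f w ≡ g w) → sumVars f ≡ sumVars g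
sumVars-cong f≡g =
  cong₂ _+_ (f≡g U) (cong₂ _+_ (f≡g V) (cong₂ _+_ (f≡g X) (cong₂ _+_ (f≡g Y) (cong (_+ 0ℤ) (f≡g Z)))))

-- the image of the term c · m under the derivation sending each variable w to κ w · γ w
∂term : (Var → ℤ) → (Var → Mono) → ℤ × Mono → Poly
∂term κ γ (c , m) = map (λ w → (c * expo w m * κ w , lower w m · γ w)) vars

preimage : Var → Mono → Mono → Mono
preimage w γ k = k · (varMono w ⁻¹ · γ) ⁻¹

lower-preimage : ∀ w γ k m → lower w m · γ ≡ k ⇔ m ≡ preimage w γ k
lower-preimage w γ k m rewrite lower-· w m | ·-assoc m (varMono w ⁻¹) γ =
  ·-solve (varMono w ⁻¹ · γ) k m

termCoeff-∂ : ∀ w κ γ c m k → termCoeff (c * expo w m * κ , lower w m · γ) k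
                               ≡ termCoeff (c , m) (preimage w γ k) * (expo w (preimage w γ k) * κ)
termCoeff-∂ w κ γ c m k rewrite eqM-cong (lower-preimage w γ k m)
  with eqM m (preimage w γ k) | eqM-reflects m (preimage w γ k)
... | true  | ofʸ refl = ℤₚ.*-assoc c _ κ
... | false | ofⁿ _    = refl

coeff-derivation : ∀ κ γ p k → coeff (concatMap (∂term κ γ) p) k ≡
  sumVars (λ w → coeff p (preimage w (γ w) k) * (expo w (preimage w (γ w) k) * κ w))
coeff-derivation κ γ [] k = refl
coeff-derivation κ γ (t@(c , m) ∷ p) k = begin
  coeff (∂term κ γ t ++ concatMap (∂term κ γ) p) k
    ≡⟨ coeff-++ (∂term κ γ t) (concatMap (∂term κ γ) p) k ⟩
  coeff (∂term κ γ t) k + coeff (concatMap (∂term κ γ) p) k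
    ≡⟨ cong₂ _+_ (sumVars-cong (λ w → termCoeff-∂ w (κ w) (γ w) c m k))
                 (coeff-derivation κ γ p k) ⟩
  sumVars (λ w → termCoeff t (ψ w) * K w) + sumVars (λ w → coeff p (ψ w) * K w)
    ≡⟨ sumVars-+ (λ w → termCoeff t (ψ w) * K w) (λ w → coeff p (ψ w) * K w) ⟨
  sumVars (λ w → termCoeff t (ψ w) * K w + coeff p (ψ w) * K w)
    ≡⟨ sumVars-cong (λ w → ℤₚ.*-distribʳ-+ (K w) (termCoeff t (ψ w)) (coeff p (ψ w))) ⟨
  sumVars (λ w → coeff (t ∷ p) (ψ w) * K w) ∎
  where
  open ≡-Reasoning
  ψ : Var → Mono
  ψ w = preimage w (γ w) k
  K : Var → ℤ
  K w = expo w (ψ w) * κ w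

derivation-cong : ∀ κ γ {p q} → p ≋ q → concatMap (∂term κ γ) p ≋ concatMap (∂term κ γ) q
derivation-cong κ γ {p} {q} p≋q = mk≋ λ k →
  trans (coeff-derivation κ γ p k)
    (trans (sumVars-cong λ w → let μ = preimage w (γ w) k in cong (_* (expo w μ * κ w)) (coeff-≡ p≋q μ))
      (sym (coeff-derivation κ γ q k)))

κ₁ : Var → ℤ
κ₁ U = 0ℤ
κ₁ V = 0ℤ
κ₁ X = 1ℤ
κ₁ Y = 1ℤ
κ₁ Z = 1ℤ

γ₂ : Var → Mono
γ₂ U = mono 0ℤ -1ℤ 1ℤ 1ℤ (+ 2)
γ₂ V = mono -1ℤ 0ℤ 1ℤ 1ℤ (+ 2)
γ₂ X = mono -1ℤ -1ℤ (+ 2) (+ 2) 1ℤ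
γ₂ Y = mono -1ℤ -1ℤ (+ 2) (+ 2) 1ℤ
γ₂ Z = mono -1ℤ -1ℤ (+ 2) (+ 2) 1ℤ

∂₁ ∂₂ : ℤ × Mono → Poly
∂₁ = ∂term κ₁ (λ _ → uv)
∂₂ = ∂term (λ _ → 1ℤ) γ₂

-- D₂ p unfolds to concatMap ∂₂ p, while D₁ p differs from concatMap ∂₁ p by zero terms for u and v
D₁-∂ : ∀ p → D₁ p ≋ concatMap ∂₁ p
D₁-∂ = concatMap-cong ∘ All.universal λ (c , m) →
  ≋-sym (≋-trans (zero-term _ (ℤₚ.*-zeroʳ (c * eu m))) (zero-term _ (ℤₚ.*-zeroʳ (c * ev m))))

D₁-cong : ∀ {p q} → p ≋ q → D₁ p ≋ D₁ q
D₁-cong {p} {q} p≋q =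
  ≋-trans (D₁-∂ p) (≋-trans (derivation-cong κ₁ (λ _ → uv) p≋q) (≋-sym (D₁-∂ q)))

D₂-cong : ∀ {p q} → p ≋ q → D₂ p ≋ D₂ q
D₂-cong = derivation-cong (λ _ → 1ℤ) γ₂

-- Statistics of words as monomials

<ᵇ-true : ∀ {m n} → m < n → (m <ᵇ n) ≡ true
<ᵇ-true = Equivalence.to T-≡ ∘ ℕₚ.<⇒<ᵇ

<ᵇ-false : ∀ {m n} → n ≤ m → (m <ᵇ n) ≡ false
<ᵇ-false {m} {n} n≤m with m <ᵇ n in m<ᵇn
... | true  = contradiction (ℕₚ.<ᵇ⇒< m n (subst T (sym m<ᵇn) tt)) (ℕₚ.≤⇒≯ n≤m)
... | false = refl

≡ᵇ-true : ∀ n → (n ≡ᵇ n) ≡ true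
≡ᵇ-true n = Equivalence.to T-≡ (ℕₚ.≡⇒≡ᵇ n n refl)

≡ᵇ-false : ∀ {m n} → m ≢ n → (m ≡ᵇ n) ≡ false
≡ᵇ-false {m} {n} m≢n with m ≡ᵇ n in m≡ᵇn
... | true  = contradiction (ℕₚ.≡ᵇ⇒≡ m n (subst T (sym m≡ᵇn) tt)) m≢n
... | false = refl

vals : Word → List ℕ
vals = map proj₁

statMono : List ℕ → Mono
statMono xs =
  mono 0ℤ 0ℤ (+ countPairs _<ᵇ_ xs) (+ countPairs (λ a b → b <ᵇ a) xs) (+ countPairs _≡ᵇ_ xs)

Lmono : Word → Mono
Lmono π = statMono (padded π)

Hmono : Word → Mono
Hmono π = uv · mono 0ℤ 0ℤ (+ asc π - 1ℤ) (+ des π - 1ℤ) (+ plat π)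

Hmono-Lmono : ∀ π → Hmono π ≡ uv · (Lmono π · xy ⁻¹)
Hmono-Lmono π =
  cong (uv ·_) (mono-ext {m′ = Lmono π · xy ⁻¹} refl refl refl refl (x≡x+0 (+ plat π)))

gapMono : ℕ × ℕ → Mono
gapMono (l , r) = statMono (l ∷ r ∷ [])

statMono-∷ : ∀ a b xs → statMono (a ∷ b ∷ xs) ≡ gapMono (a , b) · statMono (b ∷ xs)
statMono-∷ a b xs = mono-ext refl refl (split _<ᵇ_) (split (λ a b → b <ᵇ a)) (split _≡ᵇ_)
  where
  split : ∀ R → + countPairs R (a ∷ b ∷ xs) ≡ + countPairs R (a ∷ b ∷ []) + + countPairs R (b ∷ xs)
  split R = cong +_ (cong (ℕ._+ countPairs R (b ∷ xs)) (sym (ℕₚ.+-identityʳ _)))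

statMono-++ : ∀ xs a ys → statMono (xs ++ a ∷ ys) ≡ statMono (xs ++ a ∷ []) · statMono (a ∷ ys)
statMono-++ [] a ys = sym (·-identityˡ (statMono (a ∷ ys)))
statMono-++ (x ∷ []) a ys = statMono-∷ x a ys
statMono-++ (x ∷ x′ ∷ xs) a ys = begin
  statMono (x ∷ x′ ∷ xs ++ a ∷ ys)
    ≡⟨ statMono-∷ x x′ (xs ++ a ∷ ys) ⟩
  gapMono (x , x′) · statMono (x′ ∷ xs ++ a ∷ ys)
    ≡⟨ cong (gapMono (x , x′) ·_) (statMono-++ (x′ ∷ xs) a ys) ⟩
  gapMono (x , x′) · (statMono (x′ ∷ xs ++ a ∷ []) · statMono (a ∷ ys))
    ≡⟨ ·-assoc (gapMono (x , x′)) (statMono (x′ ∷ xs ++ a ∷ [])) (statMono (a ∷ ys)) ⟨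
  gapMono (x , x′) · statMono (x′ ∷ xs ++ a ∷ []) · statMono (a ∷ ys)
    ≡⟨ cong (λ m → m · statMono (a ∷ ys)) (statMono-∷ x x′ (xs ++ a ∷ [])) ⟨
  statMono (x ∷ x′ ∷ xs ++ a ∷ []) · statMono (a ∷ ys) ∎
  where open ≡-Reasoning

statMono₃ : ∀ a b c → statMono (a ∷ b ∷ c ∷ []) ≡ gapMono (a , b) · gapMono (b , c)
statMono₃ a b c = statMono-∷ a b (c ∷ [])

statMono₄ : ∀ a b c d →
  statMono (a ∷ b ∷ c ∷ d ∷ []) ≡ gapMono (a , b) · (gapMono (b , c) · gapMono (c , d))
statMono₄ a b c d =
  trans (statMono-∷ a b (c ∷ d ∷ [])) (cong (gapMono (a , b) ·_) (statMono₃ b c d))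

adjacentPairs : List ℕ → List (ℕ × ℕ)
adjacentPairs (a ∷ b ∷ xs) = (a , b) ∷ adjacentPairs (b ∷ xs)
adjacentPairs _ = []

adjacentPairs-++ : ∀ xs a ys →
  adjacentPairs (xs ++ a ∷ ys) ≡ adjacentPairs (xs ++ a ∷ []) ++ adjacentPairs (a ∷ ys)
adjacentPairs-++ [] a ys = refl
adjacentPairs-++ (x ∷ []) a ys = refl
adjacentPairs-++ (x ∷ x′ ∷ xs) a ys = cong ((x , x′) ∷_) (adjacentPairs-++ (x′ ∷ xs) a ys)

adjacentPairs-below : ∀ {N xs} → All (_< N) xs →
  All (λ g → proj₁ g < N × proj₂ g < N) (adjacentPairs xs)
adjacentPairs-below [] = []
adjacentPairs-below (_ ∷ []) = []
adjacentPairs-below (a<N ∷ b<N ∷ xs<N) = (a<N , b<N) ∷ adjacentPairs-below (b<N ∷ xs<N)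

gaps : Word → List (ℕ × ℕ)
gaps π = adjacentPairs (padded π)

padded-split : ∀ d z e → padded (d ++ z ∷ e) ≡ (0 ∷ vals d) ++ proj₁ z ∷ (vals e ++ 0 ∷ [])
padded-split d z e = cong (0 ∷_) (trans (cong (_++ 0 ∷ []) (Listₚ.map-++ proj₁ d (z ∷ e)))
                                        (Listₚ.++-assoc (vals d) (proj₁ z ∷ vals e) (0 ∷ [])))

insertEverywhere : Word → Word → List Word
insertEverywhere β [] = β ∷ []
insertEverywhere β (a ∷ π) = (β ++ a ∷ π) ∷ map (a ∷_) (insertEverywhere β π)

Pointwise-mapˡ : ∀ {A B : Set} {R : A → B → Set} (f : A → A) {xs ys} →
  Pointwise (λ x y → R (f x) y) xs ys → Pointwise R (map f xs) ys
Pointwise-mapˡ f [] = []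
Pointwise-mapˡ f (r ∷ rs) = r ∷ Pointwise-mapˡ f rs

-- the i-th insertion replaces the i-th gap (l , r) of π by the adjacent pairs of l β r
statMono-insert : ∀ β π s →
  Pointwise (λ π′ g → statMono (s ∷ vals π′ ++ 0 ∷ []) · gapMono g
                       ≡ statMono (s ∷ vals π ++ 0 ∷ []) · statMono (proj₁ g ∷ vals β ++ proj₂ g ∷ []))
            (insertEverywhere β π) (adjacentPairs (s ∷ vals π ++ 0 ∷ []))
statMono-insert β [] s = ·-comm (statMono (s ∷ vals β ++ 0 ∷ [])) (gapMono (s , 0)) ∷ []
statMono-insert β (a ∷ π) s =
  inserted-here ∷ Pointwise-mapˡ (a ∷_)
    (Pointwise.map (λ {π″} {g} → inserted-later {π″} {gapMono g} {block g}) (statMono-insert β π a₁))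
  where
  open ≡-Reasoning
  a₁ : ℕ
  a₁ = proj₁ a
  rest : List ℕ
  rest = vals π ++ 0 ∷ []
  block : ℕ × ℕ → Mono
  block (l , r) = statMono (l ∷ vals β ++ r ∷ [])
  inserted-here : statMono (s ∷ vals (β ++ a ∷ π) ++ 0 ∷ []) · gapMono (s , a₁)
                  ≡ statMono (s ∷ a₁ ∷ rest) · statMono (s ∷ vals β ++ a₁ ∷ [])
  inserted-here = begin
    statMono (s ∷ vals (β ++ a ∷ π) ++ 0 ∷ []) · gapMono (s , a₁)
      ≡⟨ cong (λ xs → statMono (s ∷ xs) · gapMono (s , a₁))
              (trans (cong (_++ 0 ∷ []) (Listₚ.map-++ proj₁ β (a ∷ π)))
                     (Listₚ.++-assoc (vals β) (a₁ ∷ vals π) (0 ∷ []))) ⟩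
    statMono ((s ∷ vals β) ++ a₁ ∷ rest) · gapMono (s , a₁)
      ≡⟨ cong (λ m → m · gapMono (s , a₁)) (statMono-++ (s ∷ vals β) a₁ rest) ⟩
    statMono (s ∷ vals β ++ a₁ ∷ []) · statMono (a₁ ∷ rest) · gapMono (s , a₁)
      ≡⟨ MonoMul.xy∙z≈zy∙x (statMono (s ∷ vals β ++ a₁ ∷ [])) (statMono (a₁ ∷ rest)) (gapMono (s , a₁))
      ⟩
    gapMono (s , a₁) · statMono (a₁ ∷ rest) · statMono (s ∷ vals β ++ a₁ ∷ [])
      ≡⟨ cong (λ m → m · statMono (s ∷ vals β ++ a₁ ∷ [])) (statMono-∷ s a₁ rest) ⟨
    statMono (s ∷ a₁ ∷ rest) · statMono (s ∷ vals β ++ a₁ ∷ []) ∎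
  inserted-later : ∀ {π″ G K} → statMono (a₁ ∷ vals π″ ++ 0 ∷ []) · G ≡ statMono (a₁ ∷ rest) · K →
                   statMono (s ∷ a₁ ∷ vals π″ ++ 0 ∷ []) · G ≡ statMono (s ∷ a₁ ∷ rest) · K
  inserted-later {π″} {G} {K} eq = begin
    statMono (s ∷ a₁ ∷ vals π″ ++ 0 ∷ []) · G
      ≡⟨ cong (λ m → m · G) (statMono-∷ s a₁ (vals π″ ++ 0 ∷ [])) ⟩
    gapMono (s , a₁) · statMono (a₁ ∷ vals π″ ++ 0 ∷ []) · G
      ≡⟨ ·-assoc (gapMono (s , a₁)) (statMono (a₁ ∷ vals π″ ++ 0 ∷ [])) G ⟩
    gapMono (s , a₁) · (statMono (a₁ ∷ vals π″ ++ 0 ∷ []) · G)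
      ≡⟨ cong (gapMono (s , a₁) ·_) eq ⟩
    gapMono (s , a₁) · (statMono (a₁ ∷ rest) · K)
      ≡⟨ ·-assoc (gapMono (s , a₁)) (statMono (a₁ ∷ rest)) K ⟨
    gapMono (s , a₁) · statMono (a₁ ∷ rest) · K
      ≡⟨ cong (λ m → m · K) (statMono-∷ s a₁ rest) ⟨
    statMono (s ∷ a₁ ∷ rest) · K ∎

gapClass : ℕ → ℕ × ℕ → Var
gapClass N (l , r) =
  if r ≡ᵇ N then U else if l ≡ᵇ N then V else if l <ᵇ r then X else if r <ᵇ l then Y else Z

data GapKind (N : ℕ) : ℕ × ℕ → Set where
  inner  : ∀ {l r} → l < N → r < N → GapKind N (l , r)
  before : ∀ {l} → l < N → GapKind N (l , N)
  after  : ∀ {r} → r < N → GapKind N (N , r)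

gapMono-< : ∀ {l r} → l < r → gapMono (l , r) ≡ varMono X
gapMono-< l<r rewrite <ᵇ-true l<r | <ᵇ-false (ℕₚ.<⇒≤ l<r) | ≡ᵇ-false (ℕₚ.<⇒≢ l<r) = refl

gapMono-> : ∀ {l r} → r < l → gapMono (l , r) ≡ varMono Y
gapMono-> r<l rewrite <ᵇ-true r<l | <ᵇ-false (ℕₚ.<⇒≤ r<l) | ≡ᵇ-false (ℕₚ.>⇒≢ r<l) = refl

gapMono-≡ : ∀ l → gapMono (l , l) ≡ varMono Z
gapMono-≡ l rewrite <ᵇ-false (ℕₚ.≤-refl {l}) | ≡ᵇ-true l = refl

gapClass-< : ∀ {N l r} → l < N → r < N → l < r → gapClass N (l , r) ≡ X
gapClass-< l<N r<N l<r rewrite ≡ᵇ-false (ℕₚ.<⇒≢ r<N) | ≡ᵇ-false (ℕₚ.<⇒≢ l<N) | <ᵇ-true l<r = refl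

gapClass-> : ∀ {N l r} → l < N → r < N → r < l → gapClass N (l , r) ≡ Y
gapClass-> l<N r<N r<l rewrite ≡ᵇ-false (ℕₚ.<⇒≢ r<N) | ≡ᵇ-false (ℕₚ.<⇒≢ l<N)
                             | <ᵇ-false (ℕₚ.<⇒≤ r<l) | <ᵇ-true r<l = refl

gapClass-≡ : ∀ {N l} → l < N → gapClass N (l , l) ≡ Z
gapClass-≡ {l = l} l<N rewrite ≡ᵇ-false (ℕₚ.<⇒≢ l<N) | <ᵇ-false (ℕₚ.≤-refl {l}) = refl

gapClass-before : ∀ {N l} → l < N → gapClass N (l , N) ≡ U
gapClass-before {N} _ rewrite ≡ᵇ-true N = refl

gapClass-after : ∀ {N r} → r < N → gapClass N (N , r) ≡ V
gapClass-after {N} r<N rewrite ≡ᵇ-false (ℕₚ.<⇒≢ r<N) | ≡ᵇ-true N = refl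

gapMono-inner : ∀ {N l r} → l < N → r < N → gapMono (l , r) ≡ varMono (gapClass N (l , r))
gapMono-inner {l = l} {r} l<N r<N with ℕₚ.<-cmp l r
... | tri< l<r _ _ rewrite gapClass-< l<N r<N l<r = gapMono-< l<r
... | tri≈ _ refl _ rewrite gapClass-≡ l<N = gapMono-≡ l
... | tri> _ _ r<l rewrite gapClass-> l<N r<N r<l = gapMono-> r<l

quotient-cong : ∀ {K K′ G G′} → K ≡ K′ → G ≡ G′ → K · G ⁻¹ ≡ K′ · G′ ⁻¹
quotient-cong = cong₂ (λ k g → k · g ⁻¹)

-- the factor by which inserting N, resp. N N, into a gap of class w changes the statistic monomial
D₁-ratio : ∀ {N l r} → l < N → r < N →
  statMono (l ∷ N ∷ r ∷ []) · gapMono (l , r) ⁻¹ ≡ xy · varMono (gapClass N (l , r)) ⁻¹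
D₁-ratio {N} {l} {r} l<N r<N =
  quotient-cong (trans (statMono₃ l N r) (cong₂ _·_ (gapMono-< l<N) (gapMono-> r<N))) (gapMono-inner l<N r<N)

block-inner : ∀ {N l r} → l < N → r < N →
  statMono (l ∷ N ∷ N ∷ r ∷ []) ≡ varMono X · (varMono Z · varMono Y)
block-inner {N} {l} {r} l<N r<N =
  trans (statMono₄ l N N r) (cong₂ _·_ (gapMono-< l<N) (cong₂ _·_ (gapMono-≡ N) (gapMono-> r<N)))

block-before : ∀ {N l} → l < N → statMono (l ∷ N ∷ N ∷ N ∷ []) ≡ varMono X · (varMono Z · varMono Z)
block-before {N} {l} l<N =
  trans (statMono₄ l N N N) (cong₂ _·_ (gapMono-< l<N) (cong₂ _·_ (gapMono-≡ N) (gapMono-≡ N)))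

block-after : ∀ {N r} → r < N → statMono (N ∷ N ∷ N ∷ r ∷ []) ≡ varMono Z · (varMono Z · varMono Y)
block-after {N} {r} r<N =
  trans (statMono₄ N N N r) (cong₂ _·_ (gapMono-≡ N) (cong₂ _·_ (gapMono-≡ N) (gapMono-> r<N)))

D₂-ratio : ∀ {N g} → GapKind N g →
  statMono (proj₁ g ∷ N ∷ N ∷ proj₂ g ∷ []) · gapMono g ⁻¹
  ≡ uv · xy ⁻¹ · (varMono (gapClass N g) ⁻¹ · γ₂ (gapClass N g))
D₂-ratio {N} {l , r} (inner l<N r<N) with ℕₚ.<-cmp l r
... | tri< l<r _ _  rewrite gapClass-< l<N r<N l<r = quotient-cong (block-inner l<N r<N) (gapMono-< l<r)
... | tri≈ _ refl _ rewrite gapClass-≡ l<N         = quotient-cong (block-inner l<N l<N) (gapMono-≡ l)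
... | tri> _ _ r<l  rewrite gapClass-> l<N r<N r<l = quotient-cong (block-inner l<N r<N) (gapMono-> r<l)
D₂-ratio (before l<N) rewrite gapClass-before l<N = quotient-cong (block-before l<N) (gapMono-< l<N)
D₂-ratio (after r<N)  rewrite gapClass-after r<N  = quotient-cong (block-after r<N) (gapMono-> r<N)

Hmono-insertion : ∀ c π′ G B K → Lmono π′ · G ≡ B · K → K · G ⁻¹ ≡ xy · varMono c ⁻¹ →
  Hmono π′ ≡ lower c B · uv
Hmono-insertion c π′ G B K π′·G≡B·K K/G≡xy/c = begin
  Hmono π′                           ≡⟨ Hmono-Lmono π′ ⟩
  uv · (Lmono π′ · xy ⁻¹)            ≡⟨ cong (λ m → uv · (m · xy ⁻¹)) L≡ ⟩
  uv · (B · (xy · C) · xy ⁻¹)        ≡⟨ mono-ext (h (eu uv) (eu B) (eu xy) (eu C))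
                                                 (h (ev uv) (ev B) (ev xy) (ev C))
                                                 (h (ex uv) (ex B) (ex xy) (ex C))
                                                 (h (ey uv) (ey B) (ey xy) (ey C))
                                                 (h (ez uv) (ez B) (ez xy) (ez C)) ⟩
  B · C · uv                         ≡⟨ cong (_· uv) (lower-· c B) ⟨
  lower c B · uv                     ∎
  where
  open ≡-Reasoning
  C : Mono
  C = varMono c ⁻¹
  L≡ : Lmono π′ ≡ B · (xy · C)
  L≡ = trans (divide (Lmono π′) G B K π′·G≡B·K) (cong (B ·_) K/G≡xy/c)
  h : ∀ u b p c → u + ((b + (p + c)) + - p) ≡ (b + c) + u
  h = solve-∀

Lmono-insertion : ∀ c A G π K → A · G ≡ Lmono π · K →
  K · G ⁻¹ ≡ uv · xy ⁻¹ · (varMono c ⁻¹ · γ₂ c) → A ≡ lower c (Hmono π) · γ₂ c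
Lmono-insertion c A G π K A·G≡L·K K/G≡ = begin
  A                                            ≡⟨ trans (divide A G L K A·G≡L·K) (cong (L ·_) K/G≡) ⟩
  L · (uv · P · (C · Γ))                       ≡⟨ mono-ext (h (eu L) (eu uv) (eu P) (eu C) (eu Γ))
                                                           (h (ev L) (ev uv) (ev P) (ev C) (ev Γ))
                                                           (h (ex L) (ex uv) (ex P) (ex C) (ex Γ))
                                                           (h (ey L) (ey uv) (ey P) (ey C) (ey Γ))
                                                           (h (ez L) (ez uv) (ez P) (ez C) (ez Γ)) ⟩
  uv · (L · P) · C · Γ                         ≡⟨ cong (λ m → m · C · Γ) (Hmono-Lmono π) ⟨
  Hmono π · C · Γ                              ≡⟨ cong (_· Γ) (lower-· c (Hmono π)) ⟨
  lower c (Hmono π) · Γ                        ∎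
  where
  open ≡-Reasoning
  L P C Γ : Mono
  L = Lmono π
  P = xy ⁻¹
  C = varMono c ⁻¹
  Γ = γ₂ c
  h : ∀ b u p c g → b + ((u + p) + (c + g)) ≡ ((u + (b + p)) + c) + g
  h = solve-∀

classProd : ℕ → List (ℕ × ℕ) → Mono
classProd N G = monoProd (map (varMono ∘ gapClass N) G)

classProd-++ : ∀ N G H → classProd N (G ++ H) ≡ classProd N G · classProd N H
classProd-++ N G H =
  trans (cong monoProd (Listₚ.map-++ class G H)) (monoProd-++ (map class G) (map class H))
  where
  class : ℕ × ℕ → Mono
  class = varMono ∘ gapClass N

classProd-statMono : ∀ {N xs} → All (_< N) xs → classProd N (adjacentPairs xs) ≡ statMono xs
classProd-statMono [] = refl
classProd-statMono (_ ∷ []) = refl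
classProd-statMono {xs = a ∷ b ∷ xs} (a<N ∷ b<N ∷ xs<N) =
  trans (cong₂ _·_ (sym (gapMono-inner a<N b<N)) (classProd-statMono (b<N ∷ xs<N))) (sym (statMono-∷ a b xs))

gapKinds-below : ∀ {N xs} → All (_< N) xs → All (GapKind N) (adjacentPairs xs)
gapKinds-below = All.map (λ (l<N , r<N) → inner l<N r<N) ∘ adjacentPairs-below

gapKinds-around : ∀ {N x xs ys} → All (_< N) (x ∷ xs) → All (_< N) ys →
  All (GapKind N) (adjacentPairs (x ∷ xs ++ N ∷ ys))
gapKinds-around {xs = []} (x<N ∷ []) [] = before x<N ∷ []
gapKinds-around {xs = []} (x<N ∷ []) (y<N ∷ ys<N) = before x<N ∷ after y<N ∷ gapKinds-below (y<N ∷ ys<N)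
gapKinds-around {xs = x′ ∷ xs} (x<N ∷ x′<N ∷ xs<N) ys<N =
  inner x<N x′<N ∷ gapKinds-around (x′<N ∷ xs<N) ys<N

classProd-before : ∀ {N x xs} → All (_< N) (x ∷ xs) →
  classProd N (adjacentPairs (x ∷ xs ++ N ∷ [])) · varMono X ≡ statMono (x ∷ xs ++ N ∷ []) · varMono U
classProd-before {N} {x} {[]} (x<N ∷ []) rewrite gapClass-before x<N =
  cong (_· varMono U) (sym (gapMono-< x<N))
classProd-before {N} {x} {x′ ∷ xs} (x<N ∷ x′<N ∷ xs<N) = begin
  c · P · varMono X                 ≡⟨ ·-assoc c P (varMono X) ⟩
  c · (P · varMono X)               ≡⟨ cong (c ·_) (classProd-before (x′<N ∷ xs<N)) ⟩
  c · (S · varMono U)               ≡⟨ ·-assoc c S (varMono U) ⟨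
  c · S · varMono U                 ≡⟨ cong (λ m → m · S · varMono U) (gapMono-inner x<N x′<N) ⟨
  gapMono (x , x′) · S · varMono U  ≡⟨ cong (_· varMono U) (statMono-∷ x x′ (xs ++ N ∷ [])) ⟨
  statMono (x ∷ x′ ∷ xs ++ N ∷ []) · varMono U ∎
  where
  open ≡-Reasoning
  c P S : Mono
  c = varMono (gapClass N (x , x′))
  P = classProd N (adjacentPairs (x′ ∷ xs ++ N ∷ []))
  S = statMono (x′ ∷ xs ++ N ∷ [])

classProd-after : ∀ {N y ys} → All (_< N) (y ∷ ys) →
  classProd N (adjacentPairs (N ∷ y ∷ ys)) · varMono Y ≡ statMono (N ∷ y ∷ ys) · varMono V
classProd-after {N} {y} {ys} (y<N ∷ ys<N) rewrite gapClass-after y<N = begin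
  varMono V · P · varMono Y   ≡⟨ MonoMul.xy∙z≈zy∙x (varMono V) P (varMono Y) ⟩
  varMono Y · P · varMono V   ≡⟨ cong (λ m → m · P · varMono V) (gapMono-> y<N) ⟨
  gapMono (N , y) · P · varMono V
    ≡⟨ cong (λ m → gapMono (N , y) · m · varMono V) (classProd-statMono (y<N ∷ ys<N)) ⟩
  gapMono (N , y) · statMono (y ∷ ys) · varMono V
    ≡⟨ cong (_· varMono V) (statMono-∷ N y ys) ⟨
  statMono (N ∷ y ∷ ys) · varMono V ∎
  where
  open ≡-Reasoning
  P : Mono
  P = classProd N (adjacentPairs (y ∷ ys))

data TopBarred (N : ℕ) : Word → Set where
  top-barred : ∀ {d e} → All (λ a → proj₁ a < N) d → All (λ a → proj₁ a < N) e →
               TopBarred N (d ++ (N , true) ∷ e)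

classProd-Hmono : ∀ {N π} → 0 < N → TopBarred N π → classProd N (gaps π) ≡ Hmono π
classProd-Hmono {N} 0<N (top-barred {d} {e} d<N e<N) = begin
  classProd N (gaps π)
    ≡⟨ cong (classProd N ∘ adjacentPairs) (padded-split d (N , true) e) ⟩
  classProd N (adjacentPairs (xs ++ N ∷ ys))
    ≡⟨ cong (classProd N) (adjacentPairs-++ xs N ys) ⟩
  classProd N (adjacentPairs (xs ++ N ∷ []) ++ adjacentPairs (N ∷ ys))
    ≡⟨ classProd-++ N (adjacentPairs (xs ++ N ∷ [])) (adjacentPairs (N ∷ ys)) ⟩
  P₁ · P₂
    ≡⟨ cong₂ _·_ (divide P₁ (varMono X) S₁ (varMono U) (classProd-before (0<N ∷ Allₚ.map⁺ d<N)))
                 (divide P₂ (varMono Y) S₂ (varMono V) (classProd-after-padded (Allₚ.map⁺ e<N))) ⟩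
  S₁ · (varMono U · varMono X ⁻¹) · (S₂ · (varMono V · varMono Y ⁻¹))
    ≡⟨ MonoMul.interchange S₁ (varMono U · varMono X ⁻¹) S₂ (varMono V · varMono Y ⁻¹) ⟩
  S₁ · S₂ · (uv · xy ⁻¹)
    ≡⟨ MonoMul.x∙yz≈y∙xz (S₁ · S₂) uv (xy ⁻¹) ⟩
  uv · (S₁ · S₂ · xy ⁻¹)
    ≡⟨ cong (λ m → uv · (m · xy ⁻¹)) (statMono-++ xs N ys) ⟨
  uv · (statMono (xs ++ N ∷ ys) · xy ⁻¹)
    ≡⟨ cong (λ m → uv · (statMono m · xy ⁻¹)) (padded-split d (N , true) e) ⟨
  uv · (Lmono π · xy ⁻¹)
    ≡⟨ Hmono-Lmono π ⟨
  Hmono π ∎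
  where
  open ≡-Reasoning
  π : Word
  π = d ++ (N , true) ∷ e
  xs ys : List ℕ
  xs = 0 ∷ vals d
  ys = vals e ++ 0 ∷ []
  P₁ P₂ S₁ S₂ : Mono
  P₁ = classProd N (adjacentPairs (xs ++ N ∷ []))
  P₂ = classProd N (adjacentPairs (N ∷ ys))
  S₁ = statMono (xs ++ N ∷ [])
  S₂ = statMono (N ∷ ys)
  classProd-after-padded : ∀ {zs} → All (_< N) zs →
    classProd N (adjacentPairs (N ∷ zs ++ 0 ∷ [])) · varMono Y ≡ statMono (N ∷ zs ++ 0 ∷ []) · varMono V
  classProd-after-padded [] = classProd-after (0<N ∷ [])
  classProd-after-padded (z<N ∷ zs<N) = classProd-after (z<N ∷ Allₚ.++⁺ zs<N (0<N ∷ []))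

Pointwise-All : ∀ {A B : Set} {R S : A → B → Set} {P : B → Set} → (∀ {x y} → R x y → P y → S x y) →
  ∀ {xs ys} → Pointwise R xs ys → All P ys → Pointwise S xs ys
Pointwise-All f [] [] = []
Pointwise-All f (r ∷ rs) (p ∷ ps) = f r p ∷ Pointwise-All f rs ps

Pointwise-map : ∀ {A B C : Set} (f : A → C) (g : B → C) {xs ys} →
  Pointwise (λ x y → f x ≡ g y) xs ys → map f xs ≡ map g ys
Pointwise-map f g = Pointwise-≡⇒≡ ∘ Pointwise.map⁺ f g

1*x*1≡x : ∀ x → 1ℤ * x * 1ℤ ≡ x
1*x*1≡x x = trans (ℤₚ.*-identityʳ (1ℤ * x)) (ℤₚ.*-identityˡ x)

Hterm Lterm : Word → ℤ × Mono
Hterm π = (1ℤ , Hmono π)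
Lterm π = (1ℤ , Lmono π)

D₁-word : ∀ {N} b π → 0 < N → All (λ a → proj₁ a < N) π →
  ∂₁ (Lterm π) ≋ map Hterm (insertEverywhere ((N , b) ∷ []) π)
D₁-word {N} b π 0<N π<N = begin
  ∂₁ (Lterm π)
    ≡⟨ Listₚ.map-cong coefficient vars ⟩
  map (λ w → (expo w (Lmono π) , Φ w)) vars
    ≡⟨ cong (λ m → map (λ w → (expo w m , Φ w)) vars) (classProd-statMono padded<N) ⟨
  map (λ w → (expo w (classProd N (gaps π)) , Φ w)) vars
    ≈⟨ collect Φ (gapClass N) (gaps π) ⟨
  map (λ g → (1ℤ , Φ (gapClass N g))) (gaps π)
    ≡⟨ Pointwise-map Hterm (λ g → (1ℤ , Φ (gapClass N g)))
         (Pointwise-All (λ {π′} {g} → step {π′} {g}) (statMono-insert ((N , b) ∷ []) π 0)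
                        (adjacentPairs-below padded<N)) ⟨
  map Hterm (insertEverywhere ((N , b) ∷ []) π) ∎
  where
  open SetoidReasoning ≋-setoid
  Φ : Var → Mono
  Φ w = lower w (Lmono π) · uv
  padded<N : All (_< N) (padded π)
  padded<N = 0<N ∷ Allₚ.++⁺ (Allₚ.map⁺ π<N) (0<N ∷ [])
  coefficient : ∀ w → (1ℤ * expo w (Lmono π) * κ₁ w , Φ w) ≡ (expo w (Lmono π) , Φ w)
  coefficient U = refl
  coefficient V = refl
  coefficient X = cong (_, Φ X) (1*x*1≡x (ex (Lmono π)))
  coefficient Y = cong (_, Φ Y) (1*x*1≡x (ey (Lmono π)))
  coefficient Z = cong (_, Φ Z) (1*x*1≡x (ez (Lmono π)))
  step : ∀ {π′ g} → Lmono π′ · gapMono g ≡ Lmono π · statMono (proj₁ g ∷ N ∷ proj₂ g ∷ []) →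
         proj₁ g < N × proj₂ g < N → Hterm π′ ≡ (1ℤ , Φ (gapClass N g))
  step {π′} {l , r} eq (l<N , r<N) =
    cong (1ℤ ,_) (Hmono-insertion (gapClass N (l , r)) π′ (gapMono (l , r)) (Lmono π)
                                  (statMono (l ∷ N ∷ r ∷ [])) eq (D₁-ratio l<N r<N))

D₂-word : ∀ {N π} → 0 < N → TopBarred N π →
  ∂₂ (Hterm π) ≋ map Lterm (insertEverywhere ((N , false) ∷ (N , false) ∷ []) π)
D₂-word {N} {π} 0<N top@(top-barred {d} {e} d<N e<N) = begin
  ∂₂ (Hterm π)
    ≡⟨ Listₚ.map-cong (λ w → cong (_, Ψ w) (1*x*1≡x (expo w (Hmono π)))) vars ⟩
  map (λ w → (expo w (Hmono π) , Ψ w)) vars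
    ≡⟨ cong (λ m → map (λ w → (expo w m , Ψ w)) vars) (classProd-Hmono 0<N top) ⟨
  map (λ w → (expo w (classProd N (gaps π)) , Ψ w)) vars
    ≈⟨ collect Ψ (gapClass N) (gaps π) ⟨
  map (λ g → (1ℤ , Ψ (gapClass N g))) (gaps π)
    ≡⟨ Pointwise-map Lterm (λ g → (1ℤ , Ψ (gapClass N g)))
         (Pointwise-All (λ {π′} {g} → step {π′} {g})
                        (statMono-insert ((N , false) ∷ (N , false) ∷ []) π 0) kinds) ⟨
  map Lterm (insertEverywhere ((N , false) ∷ (N , false) ∷ []) π) ∎
  where
  open SetoidReasoning ≋-setoid
  Ψ : Var → Mono
  Ψ w = lower w (Hmono π) · γ₂ w
  kinds : All (GapKind N) (gaps π)
  kinds = subst (All (GapKind N) ∘ adjacentPairs) (sym (padded-split d (N , true) e))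
                (gapKinds-around (0<N ∷ Allₚ.map⁺ d<N) (Allₚ.++⁺ (Allₚ.map⁺ e<N) (0<N ∷ [])))
  step : ∀ {π″ g} → Lmono π″ · gapMono g ≡ Lmono π · statMono (proj₁ g ∷ N ∷ N ∷ proj₂ g ∷ []) →
         GapKind N g → Lterm π″ ≡ (1ℤ , Ψ (gapClass N g))
  step {π″} {l , r} eq kind =
    cong (1ℤ ,_) (Lmono-insertion (gapClass N (l , r)) (Lmono π″) (gapMono (l , r)) π
                                  (statMono (l ∷ N ∷ N ∷ r ∷ [])) eq (D₂-ratio kind))

uvP⋆Hpoly : ∀ W → uvP ⋆ Hpoly W ≡ map Hterm W
uvP⋆Hpoly W = trans (Listₚ.++-identityʳ _) (sym (Listₚ.map-∘ W))

D₁-Lpoly : ∀ {N} b W → 0 < N → All (All (λ a → proj₁ a < N)) W →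
  D₁ (Lpoly W) ≋ uvP ⋆ Hpoly (concatMap (insertEverywhere ((N , b) ∷ [])) W)
D₁-Lpoly {N} b W 0<N W<N = begin
  D₁ (Lpoly W)                      ≈⟨ D₁-∂ (Lpoly W) ⟩
  concatMap ∂₁ (map Lterm W)        ≡⟨ Listₚ.concatMap-map ∂₁ Lterm W ⟩
  concatMap (∂₁ ∘ Lterm) W          ≈⟨ concatMap-cong (All.map (λ {π} → D₁-word b π 0<N) W<N) ⟩
  concatMap (map Hterm ∘ insert) W  ≡⟨ Listₚ.map-concatMap Hterm insert W ⟨
  map Hterm (concatMap insert W)    ≡⟨ uvP⋆Hpoly (concatMap insert W) ⟨
  uvP ⋆ Hpoly (concatMap insert W)  ∎
  where
  open SetoidReasoning ≋-setoid
  insert : Word → List Word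
  insert = insertEverywhere ((N , b) ∷ [])

D₂-Hpoly : ∀ {N} W → 0 < N → All (TopBarred N) W →
  D₂ (uvP ⋆ Hpoly W) ≋ Lpoly (concatMap (insertEverywhere ((N , false) ∷ (N , false) ∷ [])) W)
D₂-Hpoly {N} W 0<N W-top = begin
  D₂ (uvP ⋆ Hpoly W)                ≡⟨ cong D₂ (uvP⋆Hpoly W) ⟩
  concatMap ∂₂ (map Hterm W)        ≡⟨ Listₚ.concatMap-map ∂₂ Hterm W ⟩
  concatMap (∂₂ ∘ Hterm) W          ≈⟨ concatMap-cong (All.map (D₂-word 0<N) W-top) ⟩
  concatMap (map Lterm ∘ insert) W  ≡⟨ Listₚ.map-concatMap Lterm insert W ⟨
  Lpoly (concatMap insert W)        ∎
  where
  open SetoidReasoning ≋-setoid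
  insert : Word → List Word
  insert = insertEverywhere ((N , false) ∷ (N , false) ∷ [])

-- Legendre–Stirling words

UnbarredOf : ℕ → Letter → Set
UnbarredOf a z = proj₂ z ≡ false × proj₁ z ≡ a

Above : ℕ → Word → Set
Above a [] = ⊤
Above a (z ∷ w) = (Any (UnbarredOf a) w → a < proj₁ z) × Above a w

LS : Word → Set
LS [] = ⊤
LS (z ∷ w) = (proj₂ z ≡ false → Above (proj₁ z) w) × LS w

lookup-Any : ∀ {P : Letter → Set} w (k : Fin (length w)) → P (lookup w k) → Any P w
lookup-Any (z ∷ w) zero p = here p
lookup-Any (z ∷ w) (suc k) p = there (lookup-Any w k p)

Above⇒lookup : ∀ a w (j k : Fin (length w)) → Above a w → j Fin.< k →
  proj₂ (lookup w k) ≡ false → a ≡ proj₁ (lookup w k) → a < proj₁ (lookup w j)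
Above⇒lookup a (z ∷ w) zero (suc k) (a<z , _) _ unbarred a≡ = a<z (lookup-Any w k (unbarred , sym a≡))
Above⇒lookup a (z ∷ w) (suc j) (suc k) (_ , above) (s≤s j<k) = Above⇒lookup a w j k above j<k

lookup⇒Above : ∀ a w → (∀ (j k : Fin (length w)) → j Fin.< k →
  proj₂ (lookup w k) ≡ false → a ≡ proj₁ (lookup w k) → a < proj₁ (lookup w j)) → Above a w
lookup⇒Above a [] _ = tt
lookup⇒Above a (z ∷ w) H =
  (λ p → H zero (suc (Any.index p)) z<s (proj₁ (Anyₚ.lookup-index p)) (sym (proj₂ (Anyₚ.lookup-index p)))) ,
  lookup⇒Above a w (λ j k j<k → H (suc j) (suc k) (s<s j<k))

LS⇒IsLS : ∀ w → LS w → IsLS w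
LS⇒IsLS (z ∷ w) (above , _) zero (suc j) (suc k) _ (s≤s j<k) unbarred =
  Above⇒lookup (proj₁ z) w j k (above unbarred) j<k
LS⇒IsLS (z ∷ w) (_ , ls) (suc i) (suc j) (suc k) (s≤s i<j) (s≤s j<k) = LS⇒IsLS w ls i j k i<j j<k

IsLS⇒LS : ∀ w → IsLS w → LS w
IsLS⇒LS [] _ = tt
IsLS⇒LS (z ∷ w) H =
  (λ unbarred → lookup⇒Above (proj₁ z) w (λ j k j<k → H zero (suc j) (suc k) z<s (s<s j<k) unbarred)) ,
  IsLS⇒LS w (λ i j k i<j j<k → H (suc i) (suc j) (suc k) (s<s i<j) (s<s j<k))

Above-⊆ : ∀ {a v w} → v ⊆ w → Above a w → Above a v
Above-⊆ [] _ = tt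
Above-⊆ (y ∷ʳ v⊆w) (_ , above) = Above-⊆ v⊆w above
Above-⊆ (refl ∷ v⊆w) (a<z , above) = a<z ∘ Sublistₚ.Any-resp-⊆ v⊆w , Above-⊆ v⊆w above

LS-⊆ : ∀ {v w} → v ⊆ w → LS w → LS v
LS-⊆ [] _ = tt
LS-⊆ (y ∷ʳ v⊆w) (_ , ls) = LS-⊆ v⊆w ls
LS-⊆ (refl ∷ v⊆w) (above , ls) = Above-⊆ v⊆w ∘ above , LS-⊆ v⊆w ls

deletion-⊆ : ∀ (d : Word) z e → d ++ e ⊆ d ++ z ∷ e
deletion-⊆ d z e = Sublistₚ.++⁺ ⊆-refl (z ∷ʳ ⊆-refl)

UnbarredBelow : ℕ → Word → Set
UnbarredBelow N = All (λ y → proj₂ y ≡ false → proj₁ y < N)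

UnbarredBelow⇒¬Any : ∀ {N w} → UnbarredBelow N w → ¬ Any (UnbarredOf N) w
UnbarredBelow⇒¬Any (y<N ∷ _) (here (unbarred , refl)) = ℕₚ.<-irrefl refl (y<N unbarred)
UnbarredBelow⇒¬Any (_ ∷ w<N) (there any) = UnbarredBelow⇒¬Any w<N any

UnbarredBelow⇒Above : ∀ {N w} → UnbarredBelow N w → Above N w
UnbarredBelow⇒Above [] = tt
UnbarredBelow⇒Above (_ ∷ w<N) = ⊥-elim ∘ UnbarredBelow⇒¬Any w<N , UnbarredBelow⇒Above w<N

Any-skip : ∀ {P : Letter → Set} d {z e} → ¬ P z → Any P (d ++ z ∷ e) → Any P (d ++ e)
Any-skip [] ¬Pz (here Pz) = ⊥-elim (¬Pz Pz)
Any-skip [] ¬Pz (there p) = p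
Any-skip (y ∷ d) ¬Pz (here Py) = here Py
Any-skip (y ∷ d) ¬Pz (there p) = there (Any-skip d ¬Pz p)

Above-insert : ∀ {a z} d {e} → a < proj₁ z → Above a (d ++ e) → Above a (d ++ z ∷ e)
Above-insert [] a<z above = (λ _ → a<z) , above
Above-insert (y ∷ d) a<z (a<y , above) =
  a<y ∘ Any-skip d (λ (_ , z≡a) → ℕₚ.<⇒≢ a<z (sym z≡a)) , Above-insert d a<z above

LS-insert : ∀ {z} d {e} → UnbarredBelow (proj₁ z) d → (proj₂ z ≡ false → Above (proj₁ z) e) →
  LS (d ++ e) → LS (d ++ z ∷ e)
LS-insert [] _ above ls = above , ls
LS-insert (y ∷ d) (y<z ∷ d<z) above (above-y , ls) =
  (λ unbarred → Above-insert d (y<z unbarred) (above-y unbarred)) , LS-insert d d<z above ls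

adjacent : ∀ {N} p q s → All (λ y → proj₁ y ≤ N) q →
  LS (p ++ (N , false) ∷ q ++ (N , false) ∷ s) → q ≡ []
adjacent p [] s _ _ = refl
adjacent p (y ∷ q) s (y≤N ∷ _) ls with LS-⊆ (Sublistₚ.++⁺ˡ p ⊆-refl) ls
... | (above , _) = ⊥-elim (ℕₚ.<⇒≱ (proj₁ (above refl) (Anyₚ.++⁺ʳ q (here (refl , refl)))) y≤N)

-- Enumerating Legendre–Stirling words by insertion

insert-split : ∀ β π {w} → w ∈ insertEverywhere β π → ∃₂ λ d e → π ≡ d ++ e × w ≡ d ++ β ++ e
insert-split β [] (here refl) = [] , [] , refl , sym (Listₚ.++-identityʳ β)
insert-split β (a ∷ π) (here refl) = [] , a ∷ π , refl , refl
insert-split β (a ∷ π) (there w∈) with ∈-map⁻ (a ∷_) w∈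
... | w′ , w′∈ , refl with insert-split β π w′∈
...   | d , e , refl , refl = a ∷ d , e , refl , refl

insert-mem : ∀ β d e → d ++ β ++ e ∈ insertEverywhere β (d ++ e)
insert-mem β [] [] = here (Listₚ.++-identityʳ β)
insert-mem β [] (a ∷ e) = here refl
insert-mem β (a ∷ d) e = there (∈-map⁺ (a ∷_) (insert-mem β d e))

insert-unique : ∀ z β π → z ∉ π → Unique (insertEverywhere (z ∷ β) π)
insert-unique z β [] _ = [] ∷ []
insert-unique z β (a ∷ π) z∉ =
  All.tabulate fresh ∷ Uniqueₚ.map⁺ (proj₂ ∘ Listₚ.∷-injective) (insert-unique z β π (z∉ ∘ there))
  where
  fresh : ∀ {w} → w ∈ map (a ∷_) (insertEverywhere (z ∷ β) π) → z ∷ β ++ a ∷ π ≢ w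
  fresh w∈ eq with ∈-map⁻ (a ∷_) w∈
  ... | _ , _ , refl = z∉ (here (proj₁ (Listₚ.∷-injective eq)))

first-occurrence : ∀ {A : Set} {z : A} d d′ {r r′} → z ∉ d → z ∉ d′ →
  d ++ z ∷ r ≡ d′ ++ z ∷ r′ → d ≡ d′ × r ≡ r′
first-occurrence [] [] _ _ refl = refl , refl
first-occurrence [] (a ∷ d′) _ z∉d′ eq = ⊥-elim (z∉d′ (here (proj₁ (Listₚ.∷-injective eq))))
first-occurrence (a ∷ d) [] z∉d _ eq = ⊥-elim (z∉d (here (sym (proj₁ (Listₚ.∷-injective eq)))))
first-occurrence (a ∷ d) (a′ ∷ d′) z∉d z∉d′ eq with Listₚ.∷-injective eq
... | refl , eq′ with first-occurrence d d′ (z∉d ∘ there) (z∉d′ ∘ there) eq′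
...   | refl , r≡r′ = refl , r≡r′

insert-injective : ∀ {z β x y w} → z ∉ x → z ∉ y →
  w ∈ insertEverywhere (z ∷ β) x → w ∈ insertEverywhere (z ∷ β) y → x ≡ y
insert-injective {z} {β} {x} {y} z∉x z∉y w∈x w∈y
  with insert-split (z ∷ β) x w∈x | insert-split (z ∷ β) y w∈y
... | d , e , refl , refl | d′ , e′ , refl , w≡
  with first-occurrence d d′ (z∉x ∘ ∈-++⁺ˡ) (z∉y ∘ ∈-++⁺ˡ) w≡
...   | refl , β++e≡β++e′ = cong (d ++_) (Listₚ.++-cancelˡ β e e′ β++e≡β++e′)

concatMap-unique : ∀ {A B : Set} (F : A → List B) {xs} → Unique xs → All (Unique ∘ F) xs →
  (∀ {x y v} → x ∈ xs → y ∈ xs → v ∈ F x → v ∈ F y → x ≡ y) → Unique (concatMap F xs)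
concatMap-unique F [] [] _ = []
concatMap-unique F {x ∷ xs} (x∉ ∷ unique) (Fx-unique ∷ F-unique) same =
  Uniqueₚ.++⁺ Fx-unique (concatMap-unique F unique F-unique (λ x∈ y∈ → same (there x∈) (there y∈))) disjoint
  where
  disjoint : ∀ {v} → ¬ (v ∈ F x × v ∈ concatMap F xs)
  disjoint (v∈Fx , v∈rest) with find (∈-concatMap⁻ F {xs = xs} v∈rest)
  ... | y , y∈xs , v∈Fy = All.lookup x∉ y∈xs (same (here refl) (there y∈xs) v∈Fx v∈Fy)

Nmult-suc : ∀ n → Nmult (suc n) ≡ Nmult n ++ (suc n , false) ∷ (suc n , false) ∷ (suc n , true) ∷ []
Nmult-suc n = begin
  concatMap copies (upTo (suc n))          ≡⟨ cong (concatMap copies) (Listₚ.upTo-∷ʳ n) ⟨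
  concatMap copies (upTo n ++ [ n ])       ≡⟨ Listₚ.concatMap-++ copies (upTo n) [ n ] ⟩
  Nmult n ++ copies n ++ []                ≡⟨ cong (Nmult n ++_) (Listₚ.++-identityʳ (copies n)) ⟩
  Nmult n ++ copies n                      ∎
  where
  open ≡-Reasoning
  copies : ℕ → List Letter
  copies i = (suc i , false) ∷ (suc i , false) ∷ (suc i , true) ∷ []

Nmult-≤ : ∀ n {a} → a ∈ Nmult n → proj₁ a ≤ n
Nmult-≤ zero ()
Nmult-≤ (suc n) {a} a∈ with ∈-++⁻ (Nmult n) (subst (a ∈_) (Nmult-suc n) a∈)
... | inj₁ a∈N = ℕₚ.m≤n⇒m≤1+n (Nmult-≤ n a∈N)
... | inj₂ (here refl) = ℕₚ.≤-refl
... | inj₂ (there (here refl)) = ℕₚ.≤-refl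
... | inj₂ (there (there (here refl))) = ℕₚ.≤-refl

letters-≤ : ∀ {n π} → π ↭ Nmult n → All (λ a → proj₁ a ≤ n) π
letters-≤ π↭ = All.tabulate (Nmult-≤ _ ∘ ↭ₚ.∈-resp-↭ π↭)

unbarred-below : ∀ {n π} → π ↭ LSDmult (suc n) → UnbarredBelow (suc n) π
unbarred-below {n} π↭ = All.tabulate (below ∘ ∈-++⁻ (Nmult n) ∘ ↭ₚ.∈-resp-↭ π↭)
  where
  below : ∀ {a} → a ∈ Nmult n ⊎ a ∈ (suc n , true) ∷ [] → proj₂ a ≡ false → proj₁ a < suc n
  below (inj₁ a∈N) _ = s≤s (Nmult-≤ n a∈N)
  below (inj₂ (here refl)) ()

barInsertions pairInsertions : ℕ → List Word → List Word
barInsertions n = concatMap (insertEverywhere ((suc n , true) ∷ []))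
pairInsertions n = concatMap (insertEverywhere ((suc n , false) ∷ (suc n , false) ∷ []))

enumerates-bar : ∀ {n ls} → Enumerates (LSPerm (Nmult n)) ls →
  Enumerates (LSPerm (LSDmult (suc n))) (barInsertions n ls)
enumerates-bar {n} {ls} (ls-unique , ls-sound , ls-complete) = unique , sound , complete
  where
  N̄ : Letter
  N̄ = (suc n , true)
  N̄∉ : ∀ {π} → π ∈ ls → N̄ ∉ π
  N̄∉ π∈ N̄∈π = ℕₚ.1+n≰n (All.lookup (letters-≤ (proj₁ (ls-sound _ π∈))) N̄∈π)
  unique : Unique (barInsertions n ls)
  unique = concatMap-unique (insertEverywhere (N̄ ∷ [])) ls-unique
    (All.tabulate (λ π∈ → insert-unique N̄ [] _ (N̄∉ π∈)))
    (λ x∈ y∈ → insert-injective (N̄∉ x∈) (N̄∉ y∈))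
  sound : ∀ w → w ∈ barInsertions n ls → LSPerm (LSDmult (suc n)) w
  sound w w∈ with find (∈-concatMap⁻ (insertEverywhere (N̄ ∷ [])) {xs = ls} w∈)
  ... | π , π∈ , w∈π with insert-split (N̄ ∷ []) π w∈π | ls-sound π π∈
  ...   | d , e , refl , refl | π↭ , isLS =
    ↭-trans (↭ₚ.shift N̄ d e) (↭-trans (↭-prep N̄ π↭) (↭ₚ.++-comm (N̄ ∷ []) (Nmult n))) ,
    LS⇒IsLS _ (LS-insert d (All.map (λ a≤n _ → s≤s a≤n) (Allₚ.++⁻ˡ d (letters-≤ π↭))) (λ ())
                         (IsLS⇒LS _ isLS))
  complete : ∀ w → LSPerm (LSDmult (suc n)) w → w ∈ barInsertions n ls
  complete w (w↭ , isLS) with ∈-∃++ (↭ₚ.∈-resp-↭ (↭-sym w↭) (∈-++⁺ʳ (Nmult n) (here refl)))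
  ... | d , e , refl = ∈-concatMap⁺ (insertEverywhere (N̄ ∷ [])) {xs = ls}
    (lose (ls-complete (d ++ e) (de↭ , LS⇒IsLS _ (LS-⊆ (deletion-⊆ d N̄ e) (IsLS⇒LS _ isLS))))
          (insert-mem (N̄ ∷ []) d e))
    where
    de↭ : d ++ e ↭ Nmult n
    de↭ = ↭-trans (↭ₚ.drop-mid d (Nmult n) w↭) (↭.↭-reflexive (Listₚ.++-identityʳ (Nmult n)))

two-occurrences : ∀ {A : Set} {z : A} p r → z ∈ p ++ r →
  ∃₂ λ a b → ∃ λ c → p ++ z ∷ r ≡ a ++ z ∷ b ++ z ∷ c
two-occurrences {z = z} p r z∈ with ∈-++⁻ p z∈
... | inj₁ z∈p with ∈-∃++ z∈p
...   | a , b , refl = a , b , r , Listₚ.++-assoc a (z ∷ b) (z ∷ r)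
two-occurrences p r z∈ | inj₂ z∈r with ∈-∃++ z∈r
...   | b , c , refl = p , b , c , refl

enumerates-pair : ∀ {n hs} → Enumerates (LSPerm (LSDmult (suc n))) hs →
  Enumerates (LSPerm (Nmult (suc n))) (pairInsertions n hs)
enumerates-pair {n} {hs} (hs-unique , hs-sound , hs-complete) = unique , sound , complete
  where
  N : Letter
  N = (suc n , false)
  N∉ : ∀ {π} → π ∈ hs → N ∉ π
  N∉ π∈ N∈π = ℕₚ.<-irrefl refl (All.lookup (unbarred-below (proj₁ (hs-sound _ π∈))) N∈π refl)
  unique : Unique (pairInsertions n hs)
  unique = concatMap-unique (insertEverywhere (N ∷ N ∷ [])) hs-unique
    (All.tabulate (λ π∈ → insert-unique N (N ∷ []) _ (N∉ π∈)))
    (λ x∈ y∈ → insert-injective (N∉ x∈) (N∉ y∈))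
  sound : ∀ w → w ∈ pairInsertions n hs → LSPerm (Nmult (suc n)) w
  sound w w∈ with find (∈-concatMap⁻ (insertEverywhere (N ∷ N ∷ [])) {xs = hs} w∈)
  ... | π , π∈ , w∈π with insert-split (N ∷ N ∷ []) π w∈π | hs-sound π π∈
  ...   | d , e , refl , refl | π↭ , isLS =
    perm , LS⇒IsLS _ (LS-insert d d<N (λ _ → Above-N∷e) (LS-insert d d<N (λ _ → Above-e) (IsLS⇒LS _ isLS)))
    where
    d<N : UnbarredBelow (suc n) d
    d<N = Allₚ.++⁻ˡ d (unbarred-below π↭)
    e<N : UnbarredBelow (suc n) e
    e<N = Allₚ.++⁻ʳ d (unbarred-below π↭)
    Above-e : Above (suc n) e
    Above-e = UnbarredBelow⇒Above e<N
    Above-N∷e : Above (suc n) (N ∷ e)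
    Above-N∷e = ⊥-elim ∘ UnbarredBelow⇒¬Any e<N , Above-e
    perm : d ++ N ∷ N ∷ e ↭ Nmult (suc n)
    perm = ↭-trans (↭ₚ.shifts d (N ∷ N ∷ []))
             (↭-trans (↭-prep N (↭-prep N π↭))
               (↭-trans (↭ₚ.shifts (N ∷ N ∷ []) (Nmult n)) (↭.↭-reflexive (sym (Nmult-suc n)))))
  expand : ∀ {w} → w ↭ Nmult (suc n) → w ↭ Nmult n ++ N ∷ N ∷ (suc n , true) ∷ []
  expand {w} = subst (w ↭_) (Nmult-suc n)
  located : ∀ a c → a ++ N ∷ N ∷ c ↭ Nmult n ++ N ∷ N ∷ (suc n , true) ∷ [] → LS (a ++ N ∷ N ∷ c) →
            a ++ N ∷ N ∷ c ∈ pairInsertions n hs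
  located a c w↭ ls = ∈-concatMap⁺ (insertEverywhere (N ∷ N ∷ [])) {xs = hs}
    (lose (hs-complete (a ++ c) (ac↭ , LS⇒IsLS _ (LS-⊆ (deletion-⊆ a N c) (LS-⊆ (deletion-⊆ a N (N ∷ c)) ls))))
          (insert-mem (N ∷ N ∷ []) a c))
    where
    ac↭ : a ++ c ↭ LSDmult (suc n)
    ac↭ = ↭ₚ.drop-mid a (Nmult n) (↭ₚ.drop-mid a (Nmult n) w↭)
  middle : ∀ {P : Letter → Set} a b c → All P (a ++ N ∷ b ++ N ∷ c) → All P b
  middle a b c = Allₚ.++⁻ˡ b ∘ All.tail ∘ Allₚ.++⁻ʳ a
  complete : ∀ w → LSPerm (Nmult (suc n)) w → w ∈ pairInsertions n hs
  complete w (w↭ , isLS) with ∈-∃++ (↭ₚ.∈-resp-↭ (↭-sym (expand w↭)) (∈-++⁺ʳ (Nmult n) (here refl)))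
  ... | p , r , refl
    with two-occurrences p r
           (↭ₚ.∈-resp-↭ (↭-sym (↭ₚ.drop-mid p (Nmult n) (expand w↭))) (∈-++⁺ʳ (Nmult n) (here refl)))
  ... | a , b , c , eq
    with adjacent a b c (middle a b c (subst (All _) eq (letters-≤ w↭))) (subst LS eq (IsLS⇒LS _ isLS))
  ... | refl = subst (_∈ pairInsertions n hs) (sym eq)
                 (located a c (subst (_↭ _) eq (expand w↭)) (subst LS eq (IsLS⇒LS _ isLS)))

enumerations-↭ : ∀ {P xs ys} → Enumerates P xs → Enumerates P ys → xs ↭ ys
enumerations-↭ (xs-unique , xs-sound , xs-complete) (ys-unique , ys-sound , ys-complete) =
  ∼bag⇒↭ (unique∧set⇒bag xs-unique ys-unique
           (λ {w} → mk⇔ (ys-complete w ∘ xs-sound w) (xs-complete w ∘ ys-sound w)))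

canonical : ℕ → List Word
canonical zero = [] ∷ []
canonical (suc n) = pairInsertions n (barInsertions n (canonical n))

enumerates-canonical : ∀ n → Enumerates (LSPerm (Nmult n)) (canonical n)
enumerates-canonical zero =
  [] ∷ [] , (λ { _ (here refl) → ↭-refl , λ () }) , λ w (w↭ , _) → here (↭ₚ.↭-empty-inv w↭)
enumerates-canonical (suc n) = enumerates-pair (enumerates-bar (enumerates-canonical n))

letters-canonical : ∀ n → All (All (λ a → proj₁ a < suc n)) (canonical n)
letters-canonical n =
  All.tabulate λ π∈ → All.map s≤s (letters-≤ (proj₁ (proj₁ (proj₂ (enumerates-canonical n)) _ π∈)))

topBarred-insertions : ∀ {n ls} → All (All (λ a → proj₁ a < suc n)) ls →
  All (TopBarred (suc n)) (barInsertions n ls)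
topBarred-insertions {n} {ls} ls<N = All.tabulate placed
  where
  placed : ∀ {w} → w ∈ barInsertions n ls → TopBarred (suc n) w
  placed w∈ with find (∈-concatMap⁻ (insertEverywhere ((suc n , true) ∷ [])) {xs = ls} w∈)
  ... | π , π∈ , w∈π with insert-split ((suc n , true) ∷ []) π w∈π
  ...   | d , e , refl , refl =
    top-barred (Allₚ.++⁻ˡ d (All.lookup ls<N π∈)) (Allₚ.++⁻ʳ d (All.lookup ls<N π∈))

D₁-iterate : ∀ k → D₁ (iter k D₂D₁ xP) ≋ D₁ (Lpoly (canonical k))
D₂D₁-canonical : ∀ k → D₂ (D₁ (iter k D₂D₁ xP)) ≋ Lpoly (canonical (suc k))

-- iter 0 gives x rather than L₀ = z; only their images under D₁ agree
D₁-iterate zero = ≋-trans (isolate [] (refl ∷ refl ∷ [])) (≋-sym (isolate (refl ∷ refl ∷ []) []))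
D₁-iterate (suc k) = D₁-cong (D₂D₁-canonical k)

D₂D₁-canonical k = begin
  D₂ (D₁ (iter k D₂D₁ xP))
    ≈⟨ D₂-cong (D₁-iterate k) ⟩
  D₂ (D₁ (Lpoly (canonical k)))
    ≈⟨ D₂-cong (D₁-Lpoly true (canonical k) (s≤s z≤n) (letters-canonical k)) ⟩
  D₂ (uvP ⋆ Hpoly (barInsertions k (canonical k)))
    ≈⟨ D₂-Hpoly _ (s≤s z≤n) (topBarred-insertions (letters-canonical k)) ⟩
  Lpoly (canonical (suc k)) ∎
  where open SetoidReasoning ≋-setoid

lemma11 : (n : ℕ) → 1 ≤ n →
    (hs : List Word) → Enumerates (LSPerm (LSDmult n)) hs →
    (ls : List Word) → Enumerates (LSPerm (Nmult n)) ls →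
    (D₁ (iter (n ∸ 1) D₂D₁ xP) ≈ uvP ⋆ Hpoly hs) × (iter n D₂D₁ xP ≈ Lpoly ls)
lemma11 (suc k) _ hs hs-enumerates ls ls-enumerates = coeff-≡ H-identity , coeff-≡ L-identity
  where
  open SetoidReasoning ≋-setoid
  H-identity : D₁ (iter k D₂D₁ xP) ≋ uvP ⋆ Hpoly hs
  H-identity = begin
    D₁ (iter k D₂D₁ xP)
      ≈⟨ D₁-iterate k ⟩
    D₁ (Lpoly (canonical k))
      ≈⟨ D₁-Lpoly true (canonical k) (s≤s z≤n) (letters-canonical k) ⟩
    uvP ⋆ Hpoly (barInsertions k (canonical k))
      ≡⟨ uvP⋆Hpoly _ ⟩
    map Hterm (barInsertions k (canonical k))
      ≈⟨ ↭⇒≋ (↭ₚ.map⁺ Hterm (enumerations-↭ (enumerates-bar (enumerates-canonical k)) hs-enumerates)) ⟩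
    map Hterm hs
      ≡⟨ uvP⋆Hpoly hs ⟨
    uvP ⋆ Hpoly hs ∎
  L-identity : iter (suc k) D₂D₁ xP ≋ Lpoly ls
  L-identity = begin
    D₂ (D₁ (iter k D₂D₁ xP))
      ≈⟨ D₂D₁-canonical k ⟩
    Lpoly (canonical (suc k))
      ≈⟨ ↭⇒≋ (↭ₚ.map⁺ Lterm (enumerations-↭ (enumerates-canonical (suc k)) ls-enumerates)) ⟩
    Lpoly ls ∎
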